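{- Let $\mathbb{K}$ be a commutative ring, $F=\mathbb{K}\{x_1,\dots,x_m\}$ and $n\ge 1$. The homomorphism $\tilde\sigma_n:\mathfrak{F}^{ab}\to TS^n_{\mathbb{K}}(F)^{ab}$ induced by $\sigma_n$ is surjective and its kernel is the image $(\mathfrak{F}^n)^{ab}$ of $\mathfrak{F}^n$ in $\mathfrak{F}^{ab}$; that is, $0\to(\mathfrak{F}^n)^{ab}\to\mathfrak{F}^{ab}\xrightarrow{\tilde\sigma_n}TS^n_{\mathbb{K}}(F)^{ab}\to0$ is exact, giving a presentation of $TS^n_{\mathbb{K}}(F)^{ab}$ by generators and relations.
   Context: $TS^n_{\mathbb{K}}(F)=(F^{\otimes n})^{S_n}$; $R^{ab}=R/[R,R]$ for a $\mathbb{K}$-algebra $R$. Let $\Upsilon^+$ be the set of words of positive length in $x_1,\dots,x_m$, and $\mathbb{N}^{(\Upsilon^+)}$ the finitely supported functions $\alpha:\Upsilon^+\to\mathbb{N}$, with $|\alpha|=\sum_\upsilon\alpha(\upsilon)$. For $f_1,\dots,f_k\in F$ and $\beta\in\mathbb{N}^k$, $e^n_\beta(f_1,\dots,f_k)$ is the coefficient of $t_1^{\beta_1}\cdots t_k^{\beta_k}$ in $(1\otimes1+\sum_h t_h\otimes f_h)^{\otimes n}\in\mathbb{K}[t_1,\dots,t_k]\otimes_{\mathbb{K}}F^{\otimes n}$. For $\alpha\in\mathbb{N}^{(\Upsilon^+)}$ with support $\{\upsilon_1,\dots,\upsilon_k\}$ set $e^n_\alpha=e^n_{(\alpha(\upsilon_1),\dots,\alpha(\upsilon_k))}(\upsilon_1,\dots,\upsilon_k)$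 ($e^n_{0}=1$). Let $\mathfrak{F}$ be the free $\mathbb{K}$-module with basis $\{f_\alpha:\alpha\in\mathbb{N}^{(\Upsilon^+)}\}$ and $\sigma_n:\mathfrak{F}\to TS^n_{\mathbb{K}}(F)$ the $\mathbb{K}$-linear map with $f_\alpha\mapsto e^n_\alpha$ if $|\alpha|\le n$ and $f_\alpha\mapsto0$ otherwise. $\mathfrak{F}$ is endowed with the unique associative unital $\mathbb{K}$-algebra structure (unit $f_0$) for which every $\sigma_n$, $n\ge1$, is a $\mathbb{K}$-algebra homomorphism (its structure constants are those of the product of the $e^n_\alpha$ for $n$ large). $\mathfrak{F}^n$ is the $\mathbb{K}$-span of the $f_\alpha$ with $|\alpha|>n$. -}

module Defs where

open import Level using (Level; _⊔_)
open import Algebra.Bundles using (CommutativeRing)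
open import Data.Nat using (ℕ; zero; suc; _≤_; _≤ᵇ_; _≡ᵇ_)
open import Data.Bool using (Bool; true; false; if_then_else_; not)
open import Data.Bool.ListAction using (all)
open import Data.Fin using (Fin)
import Data.Fin as Fin
open import Data.List using (List; []; _∷_; map; foldr; length; _++_; concat; concatMap; filterᵇ; null)
open import Data.List.Properties using (≡-dec)
open import Data.List.NonEmpty using (List⁺; toList)
open import Data.List.Membership.Propositional using (_∈_)
open import Data.List.Relation.Unary.All using (All)
open import Data.Vec using (Vec; []; _∷_; tabulate; lookup)
import Data.Vec as Vec
open import Data.Fin.Permutation using (Permutation′; _⟨$⟩ʳ_)
open import Data.Product using (Σ; _×_; _,_; proj₁; proj₂; map₁)
open import Data.Sum using (_⊎_)
open import Relation.Nullary.Decidable using (⌊_⌋)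

module Setup {c ℓ : Level} (K : CommutativeRing c ℓ) (m : ℕ) where

  open CommutativeRing K using (_≈_; _+_; _*_; _-_; 0#; 1#) renaming (Carrier to 𝕂)

  -- Words in x_1..x_m (the monomial basis of F = 𝕂{x_1,..,x_m})
  Word : Set
  Word = List (Fin m)

  Word⁺ : Set
  Word⁺ = List⁺ (Fin m)

  _=w_ : Word → Word → Bool
  u =w v = ⌊ ≡-dec Fin._≟_ u v ⌋

  count : Word → List Word → ℕ
  count w []       = zero
  count w (v ∷ vs) = if w =w v then suc (count w vs) else count w vs

  sameMS : List Word → List Word → Bool
  sameMS xs ys = all (λ w → count w xs ≡ᵇ count w ys) (xs ++ ys)

  sumK : List 𝕂 → 𝕂
  sumK = foldr _+_ 0#

  -- F^{⊗n}: F is free on words, so F^{⊗n} is free on Vec Word n.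
  -- A tensor is given by its coefficient function; elements of F^{⊗n}
  -- are the finitely supported ones (see FinSupp).
  Tensor : ℕ → Set c
  Tensor n = Vec Word n → 𝕂

  _≈T_ : ∀ {n} → Tensor n → Tensor n → Set ℓ
  a ≈T b = ∀ s → a s ≈ b s

  FinSupp : ∀ {n} → Tensor n → Set ℓ
  FinSupp {n} t = Σ (List (Vec Word n)) λ L → ∀ s → (s ∈ L) ⊎ (t s ≈ 0#)

  0T : ∀ {n} → Tensor n
  0T _ = 0#

  _⊕_ _⊖_ : ∀ {n} → Tensor n → Tensor n → Tensor n
  (a ⊕ b) s = a s + b s
  (a ⊖ b) s = a s - b s

  _·T_ : ∀ {n} → 𝕂 → Tensor n → Tensor n
  (k ·T a) s = k * a s

  sumT : ∀ {n} → List (Tensor n) → Tensor n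
  sumT = foldr _⊕_ 0T

  splits : Word → List (Word × Word)
  splits []      = ([] , []) ∷ []
  splits (x ∷ w) = ([] , x ∷ w) ∷ map (map₁ (x ∷_)) (splits w)

  splitsV : ∀ {n} → Vec Word n → List (Vec Word n × Vec Word n)
  splitsV []      = ([] , []) ∷ []
  splitsV (w ∷ s) =
    concatMap (λ uv → map (λ p → (proj₁ uv ∷ proj₁ p) , (proj₂ uv ∷ proj₂ p)) (splitsV s))
              (splits w)

  -- multiplication of F^{⊗n} ((u1⊗..⊗un)(v1⊗..⊗vn) = u1v1⊗..⊗unvn)
  _⊛_ : ∀ {n} → Tensor n → Tensor n → Tensor n
  (a ⊛ b) s = sumK (map (λ uv → a (proj₁ uv) * b (proj₂ uv)) (splitsV s))

  infixl 7 _⊛_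
  infixl 6 _⊕_ _⊖_

  permuteV : ∀ {n} → Permutation′ n → Vec Word n → Vec Word n
  permuteV π s = tabulate (λ i → lookup s (π ⟨$⟩ʳ i))

  Symmetric : ∀ {n} → Tensor n → Set ℓ
  Symmetric {n} t = ∀ (π : Permutation′ n) s → t (permuteV π s) ≈ t s

  record TS (n : ℕ) : Set (c ⊔ ℓ) where
    field
      tensor : Tensor n
      finSupp : FinSupp tensor
      symm : Symmetric tensor
  open TS public

  commTermT : ∀ {n} → Tensor n → Tensor n → Tensor n → Tensor n → Tensor n
  commTermT a b c' d = a ⊛ (b ⊛ c' ⊖ c' ⊛ b) ⊛ d

  InCommTS : (n : ℕ) → Tensor n → Set (c ⊔ ℓ)
  InCommTS n t =
    Σ (List (TS n × TS n × TS n × TS n)) λ qs →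
      t ≈T sumT (map (λ { (a , b , c' , d) →
                     commTermT (tensor a) (tensor b) (tensor c') (tensor d) }) qs)

  -- e^n_α.  α ∈ ℕ^(Υ⁺) is represented as a finite multiset (list) of
  -- positive words.  Expanding (1⊗1 + Σ_h t_h ⊗ υ_h)^{⊗n}, the
  -- coefficient of t^α is the sum of the pure tensors s ∈ Word^n whose
  -- nonempty entries form exactly the multiset α (each with coefficient 1).
  nonempties : ∀ {n} → Vec Word n → List Word
  nonempties s = filterᵇ (λ w → not (null w)) (Vec.toList s)

  Multi : Set
  Multi = List Word⁺

  words : Multi → List Word
  words = map toList

  e : (n : ℕ) → Multi → Tensor n
  e n α s = if sameMS (nonempties s) (words α) then 1# else 0#

  -- 𝔉: free 𝕂-module on {f_α}; elements are finite formal sums Σ c_i f_{α_i}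
  𝔉 : Set c
  𝔉 = List (𝕂 × Multi)

  coeff : 𝔉 → Multi → 𝕂
  coeff x α = sumK (map (λ p → if sameMS (words (proj₂ p)) (words α) then proj₁ p else 0#) x)

  _≈F_ : 𝔉 → 𝔉 → Set ℓ
  x ≈F y = ∀ α → coeff x α ≈ coeff y α

  _+F_ : 𝔉 → 𝔉 → 𝔉
  _+F_ = _++_

  σbasis : (n : ℕ) → Multi → Tensor n
  σbasis n α = if length α ≤ᵇ n then e n α else 0T

  σ : (n : ℕ) → 𝔉 → Tensor n
  σ n x = sumT (map (λ p → proj₁ p ·T σbasis n (proj₂ p)) x)

  In𝔉^ : ℕ → 𝔉 → Set ℓ
  In𝔉^ n x = ∀ α → length α ≤ n → coeff x α ≈ 0#

  -- The algebra structure on 𝔉 is the unique one making every σ_k (k ≥ 1)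
  -- a homomorphism; so u = a(bc - cb)d in 𝔉 iff this holds after every σ_k.
  IsCommTerm𝔉 : 𝔉 → 𝔉 → 𝔉 → 𝔉 → 𝔉 → Set ℓ
  IsCommTerm𝔉 a b c' d u =
    ∀ k → 1 ≤ k → σ k u ≈T commTermT (σ k a) (σ k b) (σ k c') (σ k d)

  InComm𝔉 : 𝔉 → Set (c ⊔ ℓ)
  InComm𝔉 x =
    Σ (List (𝔉 × 𝔉 × 𝔉 × 𝔉 × 𝔉)) λ qs →
      All (λ { (a , b , c' , d , u) → IsCommTerm𝔉 a b c' d u }) qs ×
      (x ≈F concat (map (λ { (a , b , c' , d , u) → u }) qs))

{-# OPTIONS --safe #-}
module Submission where

-- Evaluated at a pure tensor s, σ n x is the coefficient of x at the content of s, the multiset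
-- of nonempty entries of s (σ≈coeff).  Hence σ n vanishes exactly on 𝔉^n, and a symmetric,
-- finitely supported tensor is σ n of the element of 𝔉 that lists its values on padded
-- multisets.  The product of 𝔉 is realised concretely: the value of σ k a ⊛ σ k b at s only
-- depends on the content of s, because empty entries split only as ([] , []) and permuting
-- the entries permutes the splittings, and it has finite support.  So every commutator term of
-- TS^n lifts to one of 𝔉, which gives ker σ̃_n ⊆ (𝔉^n + [𝔉,𝔉])/[𝔉,𝔉]; conversely σ n kills
-- 𝔉^n and maps commutator terms of 𝔉 to commutator terms of TS^n.

open import Defs
open import Level using (Level; _⊔_)
open import Algebra.Bundles using (AbelianGroup; CommutativeRing)
open import Data.Nat using (ℕ; _≤_)
open import Data.Product using (Σ; _×_)
open import Function.Bundles using (_⇔_)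

open import Data.Bool using (Bool; true; false; if_then_else_; not; T; T?)
open import Data.Bool.Properties using (T-≡; ⇔→≡)
open import Data.Empty using (⊥-elim)
open import Data.Fin using (zero; suc)
import Data.Fin as Fin
open import Data.Fin.Permutation using (Permutation′; _⟨$⟩ʳ_; _∘ₚ_; cast-id)
open import Data.Fin.Properties using (cast-involutive)
open import Data.List
  using (List; []; _∷_; [_]; map; foldr; length; _++_; concat; concatMap; null; replicate; filterᵇ;
         cartesianProductWith)
import Data.List as List
open import Data.List.Membership.Propositional using (_∈_; _∉_; lose; find)
open import Data.List.Membership.Propositional.Properties
  using (∈-∃++; ∈-map⁺; ∈-map⁻; ∈-++⁺ˡ; ∈-++⁺ʳ; ∈-cartesianProductWith⁺; ∈-concatMap⁺; ∈-concatMap⁻;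
         ∈-filter⁺)
import Data.List.NonEmpty as List⁺
open import Data.List.Properties using (≡-dec; length-filter; length-map; length-++)
open import Data.List.Relation.Binary.Permutation.Homogeneous using (onIndices)
open import Data.List.Relation.Binary.Permutation.Propositional
  using (_↭_; ↭-refl; ↭-prep; ↭-sym; ↭-trans; ↭⇒↭ₛ)
import Data.List.Relation.Binary.Permutation.Propositional as ↭
open import Data.List.Relation.Binary.Permutation.Propositional.Properties
  using (shift; ↭-length; ++⁺ʳ; ++-comm; ∈-resp-↭; filter-↭)
import Data.List.Relation.Binary.Permutation.Setoid as Setoid↭
open import Data.List.Relation.Binary.Permutation.Setoid.Properties using (onIndices-lookup)
open import Data.List.Relation.Unary.All using (All; []; _∷_)
import Data.List.Relation.Unary.All as All
open import Data.List.Relation.Unary.All.Properties using (all⁺; all⁻)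
open import Data.List.Relation.Unary.Any using (here; there)
import Data.Nat as ℕ
open import Data.Nat using (zero; suc; _∸_; z≤n; s≤s; pred; _≤ᵇ_; _≤?_)
open import Data.Nat.Properties
  using (suc-injective; 0≢1+n; ≡ᵇ⇒≡; ≡⇒≡ᵇ; +-∸-assoc; ≤⇒≤ᵇ; ≤-refl; ≤-trans; n≤1+n; +-suc;
         +-monoʳ-≤; +-mono-≤; m≤m+n; m≤n+m; +-0-commutativeMonoid; module ≤-Reasoning)
open import Algebra.Properties.CommutativeMonoid.Sum +-0-commutativeMonoid
  using () renaming (sum to ∑ᶠ; sum-cong-≗ to ∑ᶠ-cong-≗; sum-permute to ∑ᶠ-permute)
open import Data.Product using (_,_; proj₁; proj₂; ∃₂; map₁; map₂)
open import Data.Sum using (_⊎_; inj₁; inj₂)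
open import Data.Vec using (Vec; []; _∷_; toList)
import Data.Vec as Vec
open import Data.Vec.Properties using (length-toList; lookup∘tabulate; tabulate∘lookup; tabulate-cong)
open import Function using (_∘_)
open import Function.Bundles using (mk⇔; Equivalence)
open import Function.Indexed.Relation.Binary.Equality using (≡-setoid)
open import Relation.Binary.Bundles using (Setoid)
open import Relation.Binary.Definitions using (DecidableEquality)
import Relation.Binary.Indexed.Heterogeneous.Construct.Trivial as Trivial
open import Relation.Binary.PropositionalEquality as ≡ using (_≡_; refl; cong; cong₂; subst)
import Relation.Binary.Reasoning.Setoid
open import Relation.Nullary using (yes; no; contradiction)
open import Relation.Nullary.Decidable using (decidable-stable)

module ListSum {a ℓ} (G : AbelianGroup a ℓ) where
  open AbelianGroup G renaming (refl to ≈-refl; sym to ≈-sym; trans to ≈-trans)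
  open import Algebra.Properties.AbelianGroup G using (⁻¹-∙-comm; ε⁻¹≈ε)
  open import Algebra.Properties.CommutativeSemigroup commutativeSemigroup using (interchange)

  private variable
    b c : Level
    B C : Set b

  ∑ : List B → (B → Carrier) → Carrier
  ∑ xs f = foldr _∙_ ε (map f xs)

  ∑-cong : ∀ (xs : List B) {f g : B → Carrier} →
           (∀ {x} → x ∈ xs → f x ≈ g x) → ∑ xs f ≈ ∑ xs g
  ∑-cong []       f≈g = ≈-refl
  ∑-cong (x ∷ xs) f≈g = ∙-cong (f≈g (here refl)) (∑-cong xs (f≈g ∘ there))

  ∑-zero : ∀ (xs : List B) {f : B → Carrier} → (∀ {x} → x ∈ xs → f x ≈ ε) → ∑ xs f ≈ ε
  ∑-zero []       f≈ε = ≈-refl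
  ∑-zero (x ∷ xs) f≈ε =
    ≈-trans (∙-cong (f≈ε (here refl)) (∑-zero xs (f≈ε ∘ there))) (identityˡ ε)

  ∑-vanishes-or : ∀ {p} {P : Set p} (xs : List B) {f : B → Carrier} →
                  (∀ {x} → x ∈ xs → P ⊎ f x ≈ ε) → P ⊎ ∑ xs f ≈ ε
  ∑-vanishes-or []       _ = inj₂ ≈-refl
  ∑-vanishes-or (x ∷ xs) h with h (here refl) | ∑-vanishes-or xs (h ∘ there)
  ... | inj₁ p    | _        = inj₁ p
  ... | inj₂ _    | inj₁ p   = inj₁ p
  ... | inj₂ fx≈ε | inj₂ ∑≈ε = inj₂ (≈-trans (∙-cong fx≈ε ∑≈ε) (identityˡ ε))

  ∑-++ : ∀ (xs ys : List B) (f : B → Carrier) → ∑ (xs ++ ys) f ≈ ∑ xs f ∙ ∑ ys f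
  ∑-++ []       ys f = ≈-sym (identityˡ _)
  ∑-++ (x ∷ xs) ys f = ≈-trans (∙-congˡ (∑-++ xs ys f)) (≈-sym (assoc _ _ _))

  ∑-∙ : ∀ (xs : List B) (f g : B → Carrier) → ∑ xs (λ x → f x ∙ g x) ≈ ∑ xs f ∙ ∑ xs g
  ∑-∙ []       f g = ≈-sym (identityˡ ε)
  ∑-∙ (x ∷ xs) f g = ≈-trans (∙-congˡ (∑-∙ xs f g)) (interchange _ _ _ _)

  ∑-⁻¹ : ∀ (xs : List B) (f : B → Carrier) → ∑ xs (λ x → f x ⁻¹) ≈ ∑ xs f ⁻¹
  ∑-⁻¹ []       f = ≈-sym ε⁻¹≈ε
  ∑-⁻¹ (x ∷ xs) f = ≈-trans (∙-congˡ (∑-⁻¹ xs f)) (⁻¹-∙-comm _ _)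

  ∑-map : ∀ (g : B → C) (xs : List B) (f : C → Carrier) → ∑ (map g xs) f ≡ ∑ xs (f ∘ g)
  ∑-map g []       f = refl
  ∑-map g (x ∷ xs) f = cong (f (g x) ∙_) (∑-map g xs f)

  ∑-concatMap : ∀ (g : B → List C) (xs : List B) (f : C → Carrier) →
                ∑ (concatMap g xs) f ≈ ∑ xs (λ x → ∑ (g x) f)
  ∑-concatMap g []       f = ≈-refl
  ∑-concatMap g (x ∷ xs) f =
    ≈-trans (∑-++ (g x) (concatMap g xs) f) (∙-congˡ (∑-concatMap g xs f))

  ∑-comm : ∀ (xs : List B) (ys : List C) (f : B → C → Carrier) →
           ∑ xs (λ x → ∑ ys (f x)) ≈ ∑ ys (λ y → ∑ xs (λ x → f x y))
  ∑-comm []       ys f = ≈-sym (∑-zero ys (λ _ → ≈-refl))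
  ∑-comm (x ∷ xs) ys f = ≈-trans (∙-congˡ (∑-comm xs ys f)) (≈-sym (∑-∙ ys (f x) _))

T-⇔⇒≡ : ∀ {a b} → (T a → T b) → (T b → T a) → a ≡ b
T-⇔⇒≡ a⇒b b⇒a = ⇔→≡ (mk⇔ (to T-≡ ∘ a⇒b ∘ from T-≡) (to T-≡ ∘ b⇒a ∘ from T-≡))
  where open Equivalence

module _ {a} {A : Set a} where

  lookup-toList : ∀ {n} (v : Vec A n) .(e : length (toList v) ≡ n) i →
                  Vec.lookup v (Fin.cast e i) ≡ List.lookup (toList v) i
  lookup-toList (x ∷ v) e zero    = refl
  lookup-toList (x ∷ v) e (suc i) = lookup-toList v (cong pred e) i

  ↭⇒permutation : ∀ {n} {s t : Vec A n} → toList s ↭ toList t →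
                  Σ (Permutation′ n) λ π → ∀ i → Vec.lookup s i ≡ Vec.lookup t (π ⟨$⟩ʳ i)
  ↭⇒permutation {n} {s} {t} p = π , lookup-s≡
    where
    p′ : Setoid↭._↭_ (≡.setoid A) (toList s) (toList t)
    p′ = ↭⇒↭ₛ p
    |s|≡n : length (toList s) ≡ n
    |s|≡n = length-toList s
    |t|≡n : length (toList t) ≡ n
    |t|≡n = length-toList t
    π : Permutation′ n
    π = cast-id (≡.sym |s|≡n) ∘ₚ (onIndices p′ ∘ₚ cast-id |t|≡n)
    lookup-s≡ : ∀ i → Vec.lookup s i ≡ Vec.lookup t (π ⟨$⟩ʳ i)
    lookup-s≡ i = begin
      Vec.lookup s i
        ≡⟨ cong (Vec.lookup s) (cast-involutive |s|≡n (≡.sym |s|≡n) i) ⟨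
      Vec.lookup s (Fin.cast |s|≡n (Fin.cast (≡.sym |s|≡n) i))
        ≡⟨ lookup-toList s |s|≡n _ ⟩
      List.lookup (toList s) (Fin.cast (≡.sym |s|≡n) i)
        ≡⟨ onIndices-lookup (≡.setoid A) p′ _ ⟩
      List.lookup (toList t) _
        ≡⟨ lookup-toList t |t|≡n _ ⟨
      Vec.lookup t _
        ∎
      where open ≡.≡-Reasoning

  allVecs : (n : ℕ) → List A → List (Vec A n)
  allVecs zero    W = [ [] ]
  allVecs (suc n) W = cartesianProductWith _∷_ W (allVecs n W)

  ∈-allVecs : ∀ {n W} (s : Vec A n) → (∀ {w} → w ∈ toList s → w ∈ W) → s ∈ allVecs n W
  ∈-allVecs []      _   = here refl
  ∈-allVecs (w ∷ s) s⊆W =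
    ∈-cartesianProductWith⁺ _∷_ (s⊆W (here refl)) (∈-allVecs s (s⊆W ∘ there))

module Presentation {c ℓ : Level} (K : CommutativeRing c ℓ) (m : ℕ) where
  open Setup K m

  -- Multisets of words

  _≟w_ : DecidableEquality Word
  _≟w_ = ≡-dec Fin._≟_

  open import Data.List.Membership.DecPropositional _≟w_ using (_∈?_)

  count-here : ∀ w vs → count w (w ∷ vs) ≡ suc (count w vs)
  count-here w vs with w ≟w w
  ... | yes _   = refl
  ... | no  w≢w = contradiction refl w≢w

  ∉⇒count≡0 : ∀ {w} xs → w ∉ xs → count w xs ≡ 0
  ∉⇒count≡0     []       w∉xs = refl
  ∉⇒count≡0 {w} (v ∷ xs) w∉xs with w ≟w v
  ... | yes w≡v = contradiction (here w≡v) w∉xs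
  ... | no  _   = ∉⇒count≡0 xs (w∉xs ∘ there)

  count-↭ : ∀ {xs ys} → xs ↭ ys → ∀ w → count w xs ≡ count w ys
  count-↭ ↭.refl         w = refl
  count-↭ (↭.prep x p)   w = cong (λ k → if w =w x then suc k else k) (count-↭ p w)
  count-↭ (↭.swap x y p) w with w =w x | w =w y | count-↭ p w
  ... | true  | true  | eq = cong (λ k → suc (suc k)) eq
  ... | true  | false | eq = cong suc eq
  ... | false | true  | eq = cong suc eq
  ... | false | false | eq = eq
  count-↭ (↭.trans p q)  w = ≡.trans (count-↭ p w) (count-↭ q w)

  count-∷-cancel : ∀ w x xs ys → count w (x ∷ xs) ≡ count w (x ∷ ys) → count w xs ≡ count w ys
  count-∷-cancel w x xs ys eq with w =w x
  ... | true  = suc-injective eq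
  ... | false = eq

  count-≡⇒↭ : ∀ xs ys → (∀ w → count w xs ≡ count w ys) → xs ↭ ys
  count-≡⇒↭ []       []       _  = ↭-refl
  count-≡⇒↭ []       (y ∷ ys) eq = contradiction (≡.trans (eq y) (count-here y ys)) 0≢1+n
  count-≡⇒↭ (x ∷ xs) ys       eq with ∈-∃++ x∈ys
    where
    x∈ys : x ∈ ys
    x∈ys = decidable-stable (x ∈? ys) λ x∉ys →
      0≢1+n (≡.trans (≡.sym (∉⇒count≡0 ys x∉ys)) (≡.trans (≡.sym (eq x)) (count-here x xs)))
  ... | ys₁ , ys₂ , refl =
    ↭-trans (↭-prep x (count-≡⇒↭ xs (ys₁ ++ ys₂) eq′)) (↭-sym (shift x ys₁ ys₂))
    where
    eq′ : ∀ w → count w xs ≡ count w (ys₁ ++ ys₂)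
    eq′ w = count-∷-cancel w x xs (ys₁ ++ ys₂) (≡.trans (eq w) (count-↭ (shift x ys₁ ys₂) w))

  sameMS⇒↭ : ∀ xs ys → T (sameMS xs ys) → xs ↭ ys
  sameMS⇒↭ xs ys same = count-≡⇒↭ xs ys counts
    where
    counts : ∀ w → count w xs ≡ count w ys
    counts w with w ∈? (xs ++ ys)
    ... | yes w∈ = ≡ᵇ⇒≡ _ _ (All.lookup (all⁺ _ (xs ++ ys) same) w∈)
    ... | no  w∉ = ≡.trans (∉⇒count≡0 xs (w∉ ∘ ∈-++⁺ˡ)) (≡.sym (∉⇒count≡0 ys (w∉ ∘ ∈-++⁺ʳ xs)))

  ↭⇒sameMS : ∀ {xs ys} → xs ↭ ys → T (sameMS xs ys)
  ↭⇒sameMS {xs} {ys} p = all⁻ _ {xs ++ ys} (All.tabulate λ {w} _ → ≡⇒≡ᵇ _ _ (count-↭ p w))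

  sameMS-congʳ : ∀ xs {ys ys′} → ys ↭ ys′ → sameMS xs ys ≡ sameMS xs ys′
  sameMS-congʳ xs {ys} {ys′} p = T-⇔⇒≡
    (λ same → ↭⇒sameMS (↭-trans (sameMS⇒↭ xs ys same) p))
    (λ same → ↭⇒sameMS (↭-trans (sameMS⇒↭ xs ys′ same) (↭-sym p)))

  sameMS-sym : ∀ xs ys → sameMS xs ys ≡ sameMS ys xs
  sameMS-sym xs ys =
    T-⇔⇒≡ (↭⇒sameMS ∘ ↭-sym ∘ sameMS⇒↭ xs ys) (↭⇒sameMS ∘ ↭-sym ∘ sameMS⇒↭ ys xs)

  length-words-↭ : ∀ {α β} → words α ↭ words β → length α ≡ length β
  length-words-↭ {α} {β} p =
    ≡.trans (≡.sym (length-map List⁺.toList α)) (≡.trans (↭-length p) (length-map List⁺.toList β))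

  nonEmpty : Word → Bool
  nonEmpty w = not (null w)

  dropEmpty : List Word → List Word
  dropEmpty = filterᵇ nonEmpty

  ↭-dropEmpty : ∀ L → L ↭ dropEmpty L ++ replicate (length L ∸ length (dropEmpty L)) []
  ↭-dropEmpty []            = ↭-refl
  ↭-dropEmpty ([] ∷ L)      rewrite +-∸-assoc 1 (length-filter (T? ∘ nonEmpty) L) =
    ↭-trans (↭-prep [] (↭-dropEmpty L)) (↭-sym (shift [] (dropEmpty L) _))
  ↭-dropEmpty ((x ∷ w) ∷ L) = ↭-prep (x ∷ w) (↭-dropEmpty L)

  dropEmpty-words : ∀ α → dropEmpty (words α) ≡ words α
  dropEmpty-words []                  = refl
  dropEmpty-words ((x List⁺.∷ w) ∷ α) = cong ((x ∷ w) ∷_) (dropEmpty-words α)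

  toMulti : List Word → Multi
  toMulti []            = []
  toMulti ([] ∷ L)      = toMulti L
  toMulti ((x ∷ w) ∷ L) = (x List⁺.∷ w) ∷ toMulti L

  words-toMulti : ∀ L → words (toMulti L) ≡ dropEmpty L
  words-toMulti []            = refl
  words-toMulti ([] ∷ L)      = words-toMulti L
  words-toMulti ((x ∷ w) ∷ L) = cong ((x ∷ w) ∷_) (words-toMulti L)

  toMulti-↭ : ∀ {p p′} → p ↭ p′ → words (toMulti p) ↭ words (toMulti p′)
  toMulti-↭ {p} {p′} r rewrite words-toMulti p | words-toMulti p′ = filter-↭ (T? ∘ nonEmpty) r

  -- The multiset of nonempty entries of s, i.e. (up to rearrangement) the α with e n α s ≡ 1#.
  content : ∀ {n} → Vec Word n → Multi
  content s = toMulti (toList s)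

  words-content : ∀ {n} (s : Vec Word n) → words (content s) ≡ nonempties s
  words-content s = words-toMulti (toList s)

  length-nonempties : ∀ {n} (s : Vec Word n) → length (nonempties s) ≤ n
  length-nonempties s =
    subst (length (nonempties s) ≤_) (length-toList s) (length-filter (T? ∘ nonEmpty) (toList s))

  length-content : ∀ {n} (s : Vec Word n) → length (content s) ≤ n
  length-content s =
    subst (_≤ _) (≡.trans (cong length (≡.sym (words-content s))) (length-map List⁺.toList (content s)))
          (length-nonempties s)

  padV : (n : ℕ) → List Word → Vec Word n
  padV zero    _       = []
  padV (suc n) []      = [] ∷ padV n []
  padV (suc n) (w ∷ L) = w ∷ padV n L

  toList-padV : ∀ {n} L → length L ≤ n → toList (padV n L) ≡ L ++ replicate (n ∸ length L) []
  toList-padV {zero}  []      z≤n       = refl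
  toList-padV {suc n} []      z≤n       = cong ([] ∷_) (toList-padV [] z≤n)
  toList-padV {suc n} (w ∷ L) (s≤s L≤n) = cong (w ∷_) (toList-padV L L≤n)

  ∈-padV : ∀ n L {w} → w ∈ toList (padV n L) → w ∈ [] ∷ L
  ∈-padV (suc n) []      (here w≡[]) = here w≡[]
  ∈-padV (suc n) []      (there w∈)  = ∈-padV n [] w∈
  ∈-padV (suc n) (v ∷ L) (here w≡v)  = there (here w≡v)
  ∈-padV (suc n) (v ∷ L) (there w∈) with ∈-padV n L w∈
  ... | here w≡[] = here w≡[]
  ... | there w∈L = there (there w∈L)

  padV-↭ : ∀ {n L L′} → length L ≤ n → L ↭ L′ → toList (padV n L) ↭ toList (padV n L′)
  padV-↭ {n} {L} {L′} L≤n p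
    rewrite toList-padV L L≤n | toList-padV L′ (subst (_≤ n) (↭-length p) L≤n) | ↭-length p =
    ++⁺ʳ _ p

  content-padV : ∀ n α → length α ≤ n → content (padV n (words α)) ≡ α
  content-padV zero    []                  z≤n       = refl
  content-padV (suc n) []                  z≤n       = content-padV n [] z≤n
  content-padV (suc n) ((x List⁺.∷ w) ∷ α) (s≤s α≤n) = cong ((x List⁺.∷ w) ∷_) (content-padV n α α≤n)

  padV-nonempties-↭ : ∀ {n} (s : Vec Word n) → toList (padV n (nonempties s)) ↭ toList s
  padV-nonempties-↭ {n} s rewrite toList-padV (nonempties s) (length-nonempties s) =
    subst (λ k → nonempties s ++ replicate (k ∸ length (nonempties s)) [] ↭ toList s)
          (length-toList s) (↭-sym (↭-dropEmpty (toList s)))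

  occurs : Word → Word → ℕ
  occurs w v = if w =w v then 1 else 0

  count-toList : ∀ w {n} (s : Vec Word n) → count w (toList s) ≡ ∑ᶠ (occurs w ∘ Vec.lookup s)
  count-toList w []      = refl
  count-toList w (v ∷ s) with w =w v
  ... | true  = cong suc (count-toList w s)
  ... | false = count-toList w s

  permuteV-↭ : ∀ {n} (π : Permutation′ n) (s : Vec Word n) → toList (permuteV π s) ↭ toList s
  permuteV-↭ π s = count-≡⇒↭ _ _ λ w → begin
    count w (toList (permuteV π s))
      ≡⟨ count-toList w (permuteV π s) ⟩
    ∑ᶠ (occurs w ∘ Vec.lookup (permuteV π s))
      ≡⟨ ∑ᶠ-cong-≗ (cong (occurs w) ∘ lookup∘tabulate (Vec.lookup s ∘ (π ⟨$⟩ʳ_))) ⟩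
    ∑ᶠ (occurs w ∘ Vec.lookup s ∘ (π ⟨$⟩ʳ_))
      ≡⟨ ∑ᶠ-permute (occurs w ∘ Vec.lookup s) π ⟨
    ∑ᶠ (occurs w ∘ Vec.lookup s)
      ≡⟨ count-toList w s ⟨
    count w (toList s)
      ∎
    where open ≡.≡-Reasoning

  -- Coefficients and σ

  open CommutativeRing K
    renaming (Carrier to 𝕂; refl to ≈-refl; sym to ≈-sym; trans to ≈-trans; reflexive to ≈-reflexive)
  open ListSum +-abelianGroup
  open import Algebra.Properties.Ring ring using (-0#≈0#; //-rightDividesˡ; x≈y⇒x∙y⁻¹≈ε)
  module SetoidReasoning = Relation.Binary.Reasoning.Setoid setoid

  tensorSetoid : ℕ → Setoid c ℓ
  tensorSetoid n = ≡-setoid (Vec Word n) (Trivial.indexedSetoid setoid)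

  module TensorReasoning n = Relation.Binary.Reasoning.Setoid (tensorSetoid n)

  Symmetric-↭ : ∀ {n} {t : Tensor n} → Symmetric t → ∀ {s s′} → toList s ↭ toList s′ → t s ≈ t s′
  Symmetric-↭ {t = t} t-sym {s} {s′} p with π , s≗ ← ↭⇒permutation p =
    ≈-trans (≈-reflexive (cong t s≡πs′)) (t-sym π s′)
    where
    s≡πs′ : s ≡ permuteV π s′
    s≡πs′ = ≡.trans (≡.sym (tabulate∘lookup s)) (tabulate-cong s≗)

  coeff-resp : ∀ x {α β} → words α ↭ words β → coeff x α ≈ coeff x β
  coeff-resp x p = ∑-cong x λ {(k , γ)} _ →
    ≈-reflexive (cong (λ b → if b then k else 0#) (sameMS-congʳ (words γ) p))

  coeff-+F : ∀ x y α → coeff (x +F y) α ≈ coeff x α + coeff y α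
  coeff-+F x y α = ∑-++ x y _

  -F_ : 𝔉 → 𝔉
  -F_ = map λ (k , α) → (- k , α)

  _-F_ : 𝔉 → 𝔉 → 𝔉
  x -F y = x +F (-F y)

  infixl 6 _-F_

  coeff-negF : ∀ x α → coeff (-F x) α ≈ - coeff x α
  coeff-negF x α = begin
    coeff (-F x) α                                                      ≡⟨ ∑-map _ x _ ⟩
    ∑ x (λ (k , β) → if sameMS (words β) (words α) then - k else 0#)   ≈⟨ ∑-cong x if-neg ⟩
    ∑ x (λ (k , β) → - (if sameMS (words β) (words α) then k else 0#)) ≈⟨ ∑-⁻¹ x _ ⟩
    - coeff x α                                                         ∎
    where
    open SetoidReasoning
    if-neg : ∀ {p} → p ∈ x →
             (if sameMS (words (proj₂ p)) (words α) then - proj₁ p else 0#) ≈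
             - (if sameMS (words (proj₂ p)) (words α) then proj₁ p else 0#)
    if-neg {k , β} _ with sameMS (words β) (words α)
    ... | true  = ≈-refl
    ... | false = ≈-sym -0#≈0#

  coeff-[x-y]+y : ∀ x y α → coeff ((x -F y) +F y) α ≈ coeff x α
  coeff-[x-y]+y x y α = begin
    coeff ((x -F y) +F y) α                ≈⟨ coeff-+F (x -F y) y α ⟩
    coeff (x -F y) α + coeff y α           ≈⟨ +-congʳ (coeff-+F x (-F y) α) ⟩
    coeff x α + coeff (-F y) α + coeff y α ≈⟨ +-congʳ (+-congˡ (coeff-negF y α)) ⟩
    coeff x α - coeff y α + coeff y α      ≈⟨ //-rightDividesˡ _ _ ⟩
    coeff x α                              ∎
    where open SetoidReasoning

  coeff-support : ∀ x α → (Σ (𝕂 × Multi) λ p → p ∈ x × words (proj₂ p) ↭ words α) ⊎ coeff x α ≈ 0#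
  coeff-support []            α = inj₂ ≈-refl
  coeff-support ((k , β) ∷ x) α with sameMS (words β) (words α) in same
  ... | true  = inj₁ ((k , β) , here refl , sameMS⇒↭ (words β) (words α) (subst T (≡.sym same) _))
  ... | false with coeff-support x α
  ...   | inj₁ (p , p∈x , p↭α) = inj₁ (p , there p∈x , p↭α)
  ...   | inj₂ coeff≈0          = inj₂ (≈-trans (+-identityˡ _) coeff≈0)

  sumT-apply : ∀ {n} (ts : List (Tensor n)) s → sumT ts s ≡ ∑ ts (λ t → t s)
  sumT-apply []       s = refl
  sumT-apply (t ∷ ts) s = cong (t s +_) (sumT-apply ts s)

  σbasis-apply : ∀ n α (s : Vec Word n) →
                 σbasis n α s ≡ (if sameMS (words α) (words (content s)) then 1# else 0#)
  σbasis-apply n α s rewrite words-content s | sameMS-sym (words α) (nonempties s)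
    with length α ≤ᵇ n in α≤ᵇn
  ... | true  = refl
  ... | false with sameMS (nonempties s) (words α) in same
  ...   | false = refl
  ...   | true  = ⊥-elim (subst T α≤ᵇn (≤⇒≤ᵇ α≤n))
    where
    s↭α : nonempties s ↭ words α
    s↭α = sameMS⇒↭ (nonempties s) (words α) (subst T (≡.sym same) _)
    α≤n : length α ≤ n
    α≤n = subst (_≤ n) (≡.trans (↭-length s↭α) (length-map List⁺.toList α)) (length-nonempties s)

  σ≈coeff : ∀ n x (s : Vec Word n) → σ n x s ≈ coeff x (content s)
  σ≈coeff n x s = begin
    σ n x s                                               ≡⟨ sumT-apply (map _ x) s ⟩
    ∑ (map (λ (k , α) → k ·T σbasis n α) x) (λ t → t s)   ≡⟨ ∑-map _ x _ ⟩
    ∑ x (λ (k , α) → k * σbasis n α s)                    ≈⟨ ∑-cong x (λ {(k , α)} _ → term k α) ⟩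
    coeff x (content s)                                   ∎
    where
    open SetoidReasoning
    term : ∀ k α → k * σbasis n α s ≈ (if sameMS (words α) (words (content s)) then k else 0#)
    term k α rewrite σbasis-apply n α s with sameMS (words α) (words (content s))
    ... | true  = *-identityʳ k
    ... | false = zeroʳ k

  σ-resp-≈F : ∀ k x y → x ≈F y → σ k x ≈T σ k y
  σ-resp-≈F k x y x≈y s = ≈-trans (σ≈coeff k x s) (≈-trans (x≈y (content s)) (≈-sym (σ≈coeff k y s)))

  σ-+F : ∀ k x y → σ k (x +F y) ≈T (σ k x ⊕ σ k y)
  σ-+F k x y s = begin
    σ k (x +F y) s                             ≈⟨ σ≈coeff k (x +F y) s ⟩
    coeff (x +F y) (content s)                 ≈⟨ coeff-+F x y (content s) ⟩
    coeff x (content s) + coeff y (content s)  ≈⟨ +-cong (σ≈coeff k x s) (σ≈coeff k y s) ⟨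
    σ k x s + σ k y s                          ∎
    where open SetoidReasoning

  σ-subF : ∀ k x y → σ k (x -F y) ≈T (σ k x ⊖ σ k y)
  σ-subF k x y s = begin
    σ k (x -F y) s                      ≈⟨ σ-+F k x (-F y) s ⟩
    σ k x s + σ k (-F y) s              ≈⟨ +-congˡ (σ≈coeff k (-F y) s) ⟩
    σ k x s + coeff (-F y) (content s)  ≈⟨ +-congˡ (coeff-negF y (content s)) ⟩
    σ k x s - coeff y (content s)       ≈⟨ +-congˡ (-‿cong (σ≈coeff k y s)) ⟨
    σ k x s - σ k y s                   ∎
    where open SetoidReasoning

  In𝔉^⇒σ≈0 : ∀ n y → In𝔉^ n y → σ n y ≈T 0T
  In𝔉^⇒σ≈0 n y y∈𝔉^ s = ≈-trans (σ≈coeff n y s) (y∈𝔉^ (content s) (length-content s))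

  σ≈0⇒In𝔉^ : ∀ n y → σ n y ≈T 0T → In𝔉^ n y
  σ≈0⇒In𝔉^ n y σy≈0 α α≤n = begin
    coeff y α                             ≡⟨ cong (coeff y) (content-padV n α α≤n) ⟨
    coeff y (content (padV n (words α)))  ≈⟨ σ≈coeff n y (padV n (words α)) ⟨
    σ n y (padV n (words α))              ≈⟨ σy≈0 (padV n (words α)) ⟩
    0#                                    ∎
    where open SetoidReasoning

  wordsOf : 𝔉 → List Word
  wordsOf = concatMap (words ∘ proj₂)

  alphabet : 𝔉 → List Word
  alphabet x = [] ∷ wordsOf x

  ∈-alphabet : ∀ x {p L w} → p ∈ x → words (proj₂ p) ↭ dropEmpty L → w ∈ L → w ∈ alphabet x
  ∈-alphabet x {w = []}    _   _   _   = here refl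
  ∈-alphabet x {w = _ ∷ _} p∈x p↭L w∈L =
    there (∈-concatMap⁺ _ (lose p∈x (∈-resp-↭ (↭-sym p↭L) (∈-filter⁺ (T? ∘ nonEmpty) w∈L _))))

  length-≤-wordsOf : ∀ {x r} → r ∈ x → length (words (proj₂ r)) ≤ length (wordsOf x)
  length-≤-wordsOf {r ∷ x}  (here refl) =
    subst (length (words (proj₂ r)) ≤_) (≡.sym (length-++ (words (proj₂ r)))) (m≤m+n _ _)
  length-≤-wordsOf {r′ ∷ x} (there r∈x) =
    ≤-trans (length-≤-wordsOf r∈x) (subst (_ ≤_) (≡.sym (length-++ (words (proj₂ r′)))) (m≤n+m _ _))

  σ-finSupp : ∀ n x → FinSupp (σ n x)
  σ-finSupp n x = allVecs n (alphabet x) , support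
    where
    support : ∀ s → s ∈ allVecs n (alphabet x) ⊎ σ n x s ≈ 0#
    support s with coeff-support x (content s)
    ... | inj₁ (p , p∈x , p↭s) =
      inj₁ (∈-allVecs s (∈-alphabet x p∈x (subst (words (proj₂ p) ↭_) (words-content s) p↭s)))
    ... | inj₂ coeff≈0 = inj₂ (≈-trans (σ≈coeff n x s) coeff≈0)

  σ-symmetric : ∀ n x → Symmetric (σ n x)
  σ-symmetric n x π s = begin
    σ n x (permuteV π s)              ≈⟨ σ≈coeff n x (permuteV π s) ⟩
    coeff x (content (permuteV π s))  ≈⟨ coeff-resp x content-↭ ⟩
    coeff x (content s)               ≈⟨ σ≈coeff n x s ⟨
    σ n x s                           ∎
    where
    open SetoidReasoning
    content-↭ : words (content (permuteV π s)) ↭ words (content s)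
    content-↭ rewrite words-content (permuteV π s) | words-content s =
      filter-↭ (T? ∘ nonEmpty) (permuteV-↭ π s)

  toTS : ∀ n → 𝔉 → TS n
  toTS n x = record { tensor = σ n x ; finSupp = σ-finSupp n x ; symm = σ-symmetric n x }

  -- Lifting symmetric tensors

  -- Each candidate resets the coefficient at its own multiset, so candidates may repeat up to
  -- rearrangement.
  represent : (Multi → 𝕂) → List Multi → 𝔉
  represent G []      = []
  represent G (α ∷ Γ) = (G α - coeff (represent G Γ) α , α) ∷ represent G Γ

  coeff-represent : ∀ (G : Multi → 𝕂) → (∀ {α β} → words α ↭ words β → G α ≈ G β) →
                    ∀ Γ α → α ∈ Γ ⊎ G α ≈ 0# → coeff (represent G Γ) α ≈ G α
  coeff-represent G G-resp []      α (inj₂ Gα≈0) = ≈-sym Gα≈0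
  coeff-represent G G-resp (β ∷ Γ) α supp with sameMS (words β) (words α) in same
  ... | true  = begin
    G β - coeff (represent G Γ) β + coeff (represent G Γ) α
      ≈⟨ +-congʳ (+-congˡ (-‿cong (coeff-resp (represent G Γ) β↭α))) ⟩
    G β - coeff (represent G Γ) α + coeff (represent G Γ) α
      ≈⟨ //-rightDividesˡ _ _ ⟩
    G β
      ≈⟨ G-resp β↭α ⟩
    G α
      ∎
    where
    open SetoidReasoning
    β↭α : words β ↭ words α
    β↭α = sameMS⇒↭ (words β) (words α) (subst T (≡.sym same) _)
  ... | false = ≈-trans (+-identityˡ _) (coeff-represent G G-resp Γ α (supp′ supp))
    where
    supp′ : α ∈ β ∷ Γ ⊎ G α ≈ 0# → α ∈ Γ ⊎ G α ≈ 0#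
    supp′ (inj₁ (here refl))  = ⊥-elim (subst T same (↭⇒sameMS (↭-refl {x = words β})))
    supp′ (inj₁ (there α∈Γ)) = inj₁ α∈Γ
    supp′ (inj₂ Gα≈0)        = inj₂ Gα≈0

  module _ {n} (y : TS n) where

    -- padV truncates lists longer than n, hence the guard.
    tensorCoeff : Multi → 𝕂
    tensorCoeff α with length α ≤? n
    ... | yes _ = tensor y (padV n (words α))
    ... | no  _ = 0#

    tensorCoeff-≤ : ∀ α → length α ≤ n → tensorCoeff α ≡ tensor y (padV n (words α))
    tensorCoeff-≤ α α≤n with length α ≤? n
    ... | yes _   = refl
    ... | no  α≰n = contradiction α≤n α≰n

    tensorCoeff-resp : ∀ {α β} → words α ↭ words β → tensorCoeff α ≈ tensorCoeff β
    tensorCoeff-resp {α} {β} p with length α ≤? n | length β ≤? n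
    ... | yes α≤n | yes _   =
      Symmetric-↭ (symm y) (padV-↭ (subst (_≤ n) (≡.sym (length-map List⁺.toList α)) α≤n) p)
    ... | no  _   | no  _   = ≈-refl
    ... | yes α≤n | no  β≰n = contradiction (subst (_≤ n) (length-words-↭ p) α≤n) β≰n
    ... | no  α≰n | yes β≤n = contradiction (subst (_≤ n) (≡.sym (length-words-↭ p)) β≤n) α≰n

    tensorSupport : List Multi
    tensorSupport = map content (proj₁ (finSupp y))

    tensorCoeff-support : ∀ α → α ∈ tensorSupport ⊎ tensorCoeff α ≈ 0#
    tensorCoeff-support α with length α ≤? n
    ... | no  _   = inj₂ ≈-refl
    ... | yes α≤n with proj₂ (finSupp y) (padV n (words α))
    ...   | inj₁ pad∈ = inj₁ (subst (_∈ tensorSupport) (content-padV n α α≤n) (∈-map⁺ content pad∈))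
    ...   | inj₂ y≈0  = inj₂ y≈0

  σ-surjective : ∀ n (y : TS n) → Σ 𝔉 λ x → σ n x ≈T tensor y
  σ-surjective n y = x , σx≈y
    where
    x : 𝔉
    x = represent (tensorCoeff y) (tensorSupport y)
    σx≈y : σ n x ≈T tensor y
    σx≈y s = begin
      σ n x s
        ≈⟨ σ≈coeff n x s ⟩
      coeff x (content s)
        ≈⟨ coeff-represent (tensorCoeff y) (tensorCoeff-resp y) _ _ (tensorCoeff-support y (content s)) ⟩
      tensorCoeff y (content s)
        ≡⟨ tensorCoeff-≤ y (content s) (length-content s) ⟩
      tensor y (padV n (words (content s)))
        ≈⟨ Symmetric-↭ (symm y) (subst (λ L → toList (padV n L) ↭ toList s) (≡.sym (words-content s))
                                       (padV-nonempties-↭ s)) ⟩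
      tensor y s
        ∎
      where open SetoidReasoning

  -- Products

  consSplit : Word × Word → List Word × List Word → List Word × List Word
  consSplit (u , v) (p , q) = (u ∷ p , v ∷ q)

  splitsL : List Word → List (List Word × List Word)
  splitsL []      = [ ([] , []) ]
  splitsL (w ∷ L) = concatMap (λ uv → map (consSplit uv) (splitsL L)) (splits w)

  ∑-splitsL-∷ : ∀ w L (h : List Word × List Word → 𝕂) →
                ∑ (splitsL (w ∷ L)) h ≈ ∑ (splits w) (λ uv → ∑ (splitsL L) (h ∘ consSplit uv))
  ∑-splitsL-∷ w L h = ≈-trans (∑-concatMap _ (splits w) h)
    (∑-cong (splits w) λ {uv} _ → ≈-reflexive (∑-map (consSplit uv) (splitsL L) h))

  ∑-splitsV : ∀ {n} (s : Vec Word n) (h : List Word × List Word → 𝕂) →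
              ∑ (splitsV s) (λ (p , q) → h (toList p , toList q)) ≈ ∑ (splitsL (toList s)) h
  ∑-splitsV []      h = ≈-refl
  ∑-splitsV (w ∷ s) h = begin
    ∑ (splitsV (w ∷ s)) (λ (p , q) → h (toList p , toList q))
      ≈⟨ ∑-concatMap _ (splits w) _ ⟩
    ∑ (splits w) (λ uv → ∑ (map _ (splitsV s)) (λ (p , q) → h (toList p , toList q)))
      ≈⟨ ∑-cong (splits w) (λ {uv} _ →
           ≈-trans (≈-reflexive (∑-map _ (splitsV s) _)) (∑-splitsV s (h ∘ consSplit uv))) ⟩
    ∑ (splits w) (λ uv → ∑ (splitsL (toList s)) (h ∘ consSplit uv))
      ≈⟨ ∑-splitsL-∷ w (toList s) h ⟨
    ∑ (splitsL (toList (w ∷ s))) h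
      ∎
    where open SetoidReasoning

  SplitRespects↭ : (List Word × List Word → 𝕂) → Set ℓ
  SplitRespects↭ h = ∀ {p p′ q q′} → p ↭ p′ → q ↭ q′ → h (p , q) ≈ h (p′ , q′)

  ∑-splitsL-∷-cong : ∀ w L L′ → (∀ h → SplitRespects↭ h → ∑ (splitsL L) h ≈ ∑ (splitsL L′) h) →
                     ∀ h → SplitRespects↭ h → ∑ (splitsL (w ∷ L)) h ≈ ∑ (splitsL (w ∷ L′)) h
  ∑-splitsL-∷-cong w L L′ L≈L′ h h-resp = begin
    ∑ (splitsL (w ∷ L)) h
      ≈⟨ ∑-splitsL-∷ w L h ⟩
    ∑ (splits w) (λ uv → ∑ (splitsL L) (h ∘ consSplit uv))
      ≈⟨ ∑-cong (splits w) (λ {uv} _ →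
           L≈L′ (h ∘ consSplit uv) (λ p q → h-resp (↭-prep _ p) (↭-prep _ q))) ⟩
    ∑ (splits w) (λ uv → ∑ (splitsL L′) (h ∘ consSplit uv))
      ≈⟨ ∑-splitsL-∷ w L′ h ⟨
    ∑ (splitsL (w ∷ L′)) h
      ∎
    where open SetoidReasoning

  ∑-splitsL-swap : ∀ w w′ L h → SplitRespects↭ h →
                   ∑ (splitsL (w ∷ w′ ∷ L)) h ≈ ∑ (splitsL (w′ ∷ w ∷ L)) h
  ∑-splitsL-swap w w′ L h h-resp = begin
    ∑ (splitsL (w ∷ w′ ∷ L)) h
      ≈⟨ ∑-splitsL-∷ w (w′ ∷ L) h ⟩
    ∑ (splits w) (λ uv → ∑ (splitsL (w′ ∷ L)) (h ∘ consSplit uv))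
      ≈⟨ ∑-cong (splits w) (λ _ → ∑-splitsL-∷ w′ L _) ⟩
    ∑ (splits w) (λ uv → ∑ (splits w′) (λ uv′ → ∑ (splitsL L) (h ∘ consSplit uv ∘ consSplit uv′)))
      ≈⟨ ∑-comm (splits w) (splits w′) _ ⟩
    ∑ (splits w′) (λ uv′ → ∑ (splits w) (λ uv → ∑ (splitsL L) (h ∘ consSplit uv ∘ consSplit uv′)))
      ≈⟨ ∑-cong (splits w′) (λ _ → ∑-cong (splits w) (λ _ → ∑-cong (splitsL L) (λ _ →
           h-resp (↭.swap _ _ ↭-refl) (↭.swap _ _ ↭-refl)))) ⟩
    ∑ (splits w′) (λ uv′ → ∑ (splits w) (λ uv → ∑ (splitsL L) (h ∘ consSplit uv′ ∘ consSplit uv)))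
      ≈⟨ ∑-cong (splits w′) (λ _ → ∑-splitsL-∷ w L _) ⟨
    ∑ (splits w′) (λ uv′ → ∑ (splitsL (w ∷ L)) (h ∘ consSplit uv′))
      ≈⟨ ∑-splitsL-∷ w′ (w ∷ L) h ⟨
    ∑ (splitsL (w′ ∷ w ∷ L)) h
      ∎
    where open SetoidReasoning

  ∑-splitsL-↭ : ∀ {L L′} → L ↭ L′ → ∀ h → SplitRespects↭ h → ∑ (splitsL L) h ≈ ∑ (splitsL L′) h
  ∑-splitsL-↭ ↭.refl                           h h-resp = ≈-refl
  ∑-splitsL-↭ (↭.prep {xs = L} {ys = L′} w p)         = ∑-splitsL-∷-cong w L L′ (∑-splitsL-↭ p)
  ∑-splitsL-↭ (↭.swap {xs = L} {ys = L′} w w′ p) h h-resp = ≈-trans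
    (∑-splitsL-∷-cong w (w′ ∷ L) (w′ ∷ L′) (∑-splitsL-∷-cong w′ L L′ (∑-splitsL-↭ p)) h h-resp)
    (∑-splitsL-swap w w′ L′ h h-resp)
  ∑-splitsL-↭ (↭.trans p q)                    h h-resp =
    ≈-trans (∑-splitsL-↭ p h h-resp) (∑-splitsL-↭ q h h-resp)

  ∑-splitsL-empties : ∀ k L h → (∀ p q → h ([] ∷ p , [] ∷ q) ≈ h (p , q)) →
                      ∑ (splitsL (replicate k [] ++ L)) h ≈ ∑ (splitsL L) h
  ∑-splitsL-empties zero    L h h-[] = ≈-refl
  ∑-splitsL-empties (suc k) L h h-[] = begin
    ∑ (splitsL ([] ∷ replicate k [] ++ L)) h
      ≈⟨ ∑-splitsL-∷ [] (replicate k [] ++ L) h ⟩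
    ∑ (splitsL (replicate k [] ++ L)) (h ∘ consSplit ([] , [])) + 0#
      ≈⟨ +-identityʳ _ ⟩
    ∑ (splitsL (replicate k [] ++ L)) (h ∘ consSplit ([] , []))
      ≈⟨ ∑-cong (splitsL (replicate k [] ++ L)) (λ _ → h-[] _ _) ⟩
    ∑ (splitsL (replicate k [] ++ L)) h
      ≈⟨ ∑-splitsL-empties k L h h-[] ⟩
    ∑ (splitsL L) h
      ∎
    where open SetoidReasoning

  ∑-splitsL-dropEmpty : ∀ L h → SplitRespects↭ h → (∀ p q → h ([] ∷ p , [] ∷ q) ≈ h (p , q)) →
                        ∑ (splitsL L) h ≈ ∑ (splitsL (dropEmpty L)) h
  ∑-splitsL-dropEmpty L h h-resp h-[] =
    ≈-trans (∑-splitsL-↭ (↭-trans (↭-dropEmpty L) (++-comm (dropEmpty L) _)) h h-resp)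
            (∑-splitsL-empties (length L ∸ length (dropEmpty L)) (dropEmpty L) h h-[])

  splits-++ : ∀ w {uv} → uv ∈ splits w → proj₁ uv ++ proj₂ uv ≡ w
  splits-++ []      (here refl) = refl
  splits-++ (x ∷ w) (here refl) = refl
  splits-++ (x ∷ w) (there uv∈) with ∈-map⁻ (map₁ (x ∷_)) uv∈
  ... | _ , uv′∈ , refl = cong (x ∷_) (splits-++ w uv′∈)

  data Split : List Word → List Word → List Word → Set where
    []   : Split [] [] []
    cons : ∀ u v {L p q} → Split L p q → Split ((u ++ v) ∷ L) (u ∷ p) (v ∷ q)

  splitsL-Split : ∀ L {pq} → pq ∈ splitsL L → Split L (proj₁ pq) (proj₂ pq)
  splitsL-Split []      (here refl) = []
  splitsL-Split (w ∷ L) pq∈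
    with find (∈-concatMap⁻ (λ uv → map (consSplit uv) (splitsL L)) {splits w} pq∈)
  ... | (u , v) , uv∈ , pq∈′ with ∈-map⁻ (consSplit (u , v)) pq∈′
  ...   | (p , q) , pq∈L , refl =
    subst (λ w′ → Split (w′ ∷ L) (u ∷ p) (v ∷ q)) (splits-++ w uv∈) (cons u v (splitsL-Split L pq∈L))

  length-dropEmpty-∷ : ∀ v q → length (dropEmpty q) ≤ length (dropEmpty (v ∷ q))
  length-dropEmpty-∷ []      q = ≤-refl
  length-dropEmpty-∷ (_ ∷ _) q = n≤1+n _

  Split-length : ∀ {L p q} → Split L p q →
                 length (dropEmpty L) ≤ length (dropEmpty p) ℕ.+ length (dropEmpty q)
  Split-length []                                     = z≤n
  Split-length (cons []      []      s)               = Split-length s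
  Split-length (cons []      (_ ∷ _) {L} {p} {q} s) =
    subst (suc (length (dropEmpty L)) ≤_) (≡.sym (+-suc (length (dropEmpty p)) (length (dropEmpty q))))
          (s≤s (Split-length s))
  Split-length (cons (_ ∷ _) v       {L} {p} {q} s) =
    s≤s (≤-trans (Split-length s) (+-monoʳ-≤ (length (dropEmpty p)) (length-dropEmpty-∷ v q)))

  Split-∈ : ∀ {L p q w} → Split L p q → w ∈ L → ∃₂ λ u v → u ∈ p × v ∈ q × w ≡ u ++ v
  Split-∈ (cons u v s) (here refl) = u , v , here refl , here refl , refl
  Split-∈ (cons u v s) (there w∈) with Split-∈ s w∈
  ... | u , v , u∈ , v∈ , w≡uv = u , v , there u∈ , there v∈ , w≡uv

  module Product (a b : 𝔉) where

    splitCoeff : List Word × List Word → 𝕂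
    splitCoeff (p , q) = coeff a (toMulti p) * coeff b (toMulti q)

    splitCoeff-resp : SplitRespects↭ splitCoeff
    splitCoeff-resp p q = *-cong (coeff-resp a (toMulti-↭ p)) (coeff-resp b (toMulti-↭ q))

    productCoeff : Multi → 𝕂
    productCoeff α = ∑ (splitsL (words α)) splitCoeff

    productCoeff-resp : ∀ {α β} → words α ↭ words β → productCoeff α ≈ productCoeff β
    productCoeff-resp p = ∑-splitsL-↭ p splitCoeff splitCoeff-resp

    productBound : ℕ
    productBound = length (wordsOf a) ℕ.+ length (wordsOf b)

    productAlphabet : List Word
    productAlphabet = cartesianProductWith _++_ (alphabet a) (alphabet b)

    -- A multiset with a nonvanishing product coefficient has at most productBound words, each of
    -- the form u ++ v with u in the alphabet of a and v in that of b (Split⇒∈productSupport).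
    productSupport : List Multi
    productSupport = map content (allVecs productBound productAlphabet)

    Split⇒∈productSupport :
      ∀ α {p q r t} → Split (words α) p q →
      r ∈ a → words (proj₂ r) ↭ dropEmpty p → t ∈ b → words (proj₂ t) ↭ dropEmpty q →
      α ∈ productSupport
    Split⇒∈productSupport α {p} {q} {r} {t} split r∈a r↭p t∈b t↭q =
      subst (_∈ productSupport) (content-padV productBound α α≤bound)
            (∈-map⁺ content (∈-allVecs _ entries))
      where
      α≤bound : length α ≤ productBound
      α≤bound = begin
        length α                                               ≡⟨ length-map List⁺.toList α ⟨
        length (words α)                                       ≡⟨ cong length (dropEmpty-words α) ⟨
        length (dropEmpty (words α))                           ≤⟨ Split-length split ⟩
        length (dropEmpty p) ℕ.+ length (dropEmpty q)
          ≡⟨ cong₂ ℕ._+_ (↭-length r↭p) (↭-length t↭q) ⟨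
        length (words (proj₂ r)) ℕ.+ length (words (proj₂ t))
          ≤⟨ +-mono-≤ (length-≤-wordsOf r∈a) (length-≤-wordsOf t∈b) ⟩
        productBound                                           ∎
        where open ≤-Reasoning
      entries : ∀ {w} → w ∈ toList (padV productBound (words α)) → w ∈ productAlphabet
      entries w∈ with ∈-padV productBound (words α) w∈
      ... | here refl = ∈-cartesianProductWith⁺ _++_ {alphabet a} {alphabet b} (here refl) (here refl)
      ... | there w∈α with Split-∈ split w∈α
      ...   | u , v , u∈p , v∈q , refl =
        ∈-cartesianProductWith⁺ _++_ (∈-alphabet a r∈a r↭p u∈p) (∈-alphabet b t∈b t↭q v∈q)

    splitCoeff-support : ∀ α {pq} → pq ∈ splitsL (words α) → α ∈ productSupport ⊎ splitCoeff pq ≈ 0#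
    splitCoeff-support α {p , q} pq∈ with coeff-support a (toMulti p) | coeff-support b (toMulti q)
    ... | inj₂ a≈0 | _        = inj₂ (≈-trans (*-congʳ a≈0) (zeroˡ _))
    ... | inj₁ _   | inj₂ b≈0 = inj₂ (≈-trans (*-congˡ b≈0) (zeroʳ _))
    ... | inj₁ (r , r∈a , r↭p) | inj₁ (t , t∈b , t↭q) =
      inj₁ (Split⇒∈productSupport α (splitsL-Split (words α) pq∈)
              r∈a (subst (_ ↭_) (words-toMulti p) r↭p) t∈b (subst (_ ↭_) (words-toMulti q) t↭q))

    productCoeff-support : ∀ α → α ∈ productSupport ⊎ productCoeff α ≈ 0#
    productCoeff-support α = ∑-vanishes-or (splitsL (words α)) (splitCoeff-support α)

  _*F_ : 𝔉 → 𝔉 → 𝔉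
  a *F b = represent productCoeff productSupport
    where open Product a b

  infixl 7 _*F_

  σ-*F : ∀ k a b → σ k (a *F b) ≈T (σ k a ⊛ σ k b)
  σ-*F k a b s = begin
    σ k (a *F b) s
      ≈⟨ σ≈coeff k (a *F b) s ⟩
    coeff (a *F b) (content s)
      ≈⟨ coeff-represent productCoeff productCoeff-resp _ _ (productCoeff-support (content s)) ⟩
    productCoeff (content s)
      ≡⟨ cong (λ L → ∑ (splitsL L) splitCoeff) (words-content s) ⟩
    ∑ (splitsL (nonempties s)) splitCoeff
      ≈⟨ ∑-splitsL-dropEmpty (toList s) splitCoeff splitCoeff-resp (λ _ _ → ≈-refl) ⟨
    ∑ (splitsL (toList s)) splitCoeff
      ≈⟨ ∑-splitsV s splitCoeff ⟨
    ∑ (splitsV s) (λ (p , q) → coeff a (content p) * coeff b (content q))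
      ≈⟨ ∑-cong (splitsV s) (λ _ → *-cong (σ≈coeff k a _) (σ≈coeff k b _)) ⟨
    (σ k a ⊛ σ k b) s
      ∎
    where
    open SetoidReasoning
    open Product a b

  -- Commutators and the kernel

  ⊛-cong : ∀ {n} {a a′ b b′ : Tensor n} → a ≈T a′ → b ≈T b′ → (a ⊛ b) ≈T (a′ ⊛ b′)
  ⊛-cong a≈a′ b≈b′ s = ∑-cong (splitsV s) (λ _ → *-cong (a≈a′ _) (b≈b′ _))

  ⊖-cong : ∀ {n} {a a′ b b′ : Tensor n} → a ≈T a′ → b ≈T b′ → (a ⊖ b) ≈T (a′ ⊖ b′)
  ⊖-cong a≈a′ b≈b′ s = +-cong (a≈a′ s) (-‿cong (b≈b′ s))

  commTermT-cong : ∀ {n} {a a′ b b′ c′ c″ d d′ : Tensor n} → a ≈T a′ → b ≈T b′ → c′ ≈T c″ → d ≈T d′ →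
                   commTermT a b c′ d ≈T commTermT a′ b′ c″ d′
  commTermT-cong a≈ b≈ c≈ d≈ = ⊛-cong (⊛-cong a≈ (⊖-cong (⊛-cong b≈ c≈) (⊛-cong c≈ b≈))) d≈

  commF : 𝔉 → 𝔉 → 𝔉 → 𝔉 → 𝔉
  commF a b c′ d = a *F (b *F c′ -F c′ *F b) *F d

  σ-commF : ∀ k a b c′ d → σ k (commF a b c′ d) ≈T commTermT (σ k a) (σ k b) (σ k c′) (σ k d)
  σ-commF k a b c′ d = begin
    σ k (a *F [b,c′] *F d)                            ≈⟨ σ-*F k (a *F [b,c′]) d ⟩
    σ k (a *F [b,c′]) ⊛ σ k d                         ≈⟨ ⊛-cong (σ-*F k a [b,c′]) ≈T-refl ⟩
    σ k a ⊛ σ k [b,c′] ⊛ σ k d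
      ≈⟨ ⊛-cong (⊛-cong ≈T-refl (σ-subF k (b *F c′) (c′ *F b))) ≈T-refl ⟩
    σ k a ⊛ (σ k (b *F c′) ⊖ σ k (c′ *F b)) ⊛ σ k d
      ≈⟨ ⊛-cong (⊛-cong ≈T-refl (⊖-cong (σ-*F k b c′) (σ-*F k c′ b))) ≈T-refl ⟩
    σ k a ⊛ (σ k b ⊛ σ k c′ ⊖ σ k c′ ⊛ σ k b) ⊛ σ k d ∎
    where
    open TensorReasoning k
    open Setoid (tensorSetoid k) using () renaming (refl to ≈T-refl)
    [b,c′] : 𝔉
    [b,c′] = b *F c′ -F c′ *F b

  commTermTS : ∀ {n} → TS n × TS n × TS n × TS n → Tensor n
  commTermTS (a , b , c′ , d) = commTermT (tensor a) (tensor b) (tensor c′) (tensor d)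

  IsCommTerm : 𝔉 × 𝔉 × 𝔉 × 𝔉 × 𝔉 → Set ℓ
  IsCommTerm (a , b , c′ , d , u) = IsCommTerm𝔉 a b c′ d u

  termOf : 𝔉 × 𝔉 × 𝔉 × 𝔉 × 𝔉 → 𝔉
  termOf (_ , _ , _ , _ , u) = u

  InCommTS-resp : ∀ {n t t′} → t ≈T t′ → InCommTS n t′ → InCommTS n t
  InCommTS-resp t≈t′ (ts , t′≈) = ts , λ s → ≈-trans (t≈t′ s) (t′≈ s)

  σ-concat-commTerms : ∀ {n} → 1 ≤ n → ∀ qs → All IsCommTerm qs →
                       InCommTS n (σ n (concat (map termOf qs)))
  σ-concat-commTerms         1≤n []                          []                 = [] , λ _ → ≈-refl
  σ-concat-commTerms {n} 1≤n ((a , b , c′ , d , u) ∷ qs) (u-comm ∷ qs-comm)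
    with ts , rest≈ ← σ-concat-commTerms 1≤n qs qs-comm =
    (toTS n a , toTS n b , toTS n c′ , toTS n d) ∷ ts , λ s → begin
      σ n (u +F concat (map termOf qs)) s       ≈⟨ σ-+F n u _ s ⟩
      σ n u s + σ n (concat (map termOf qs)) s  ≈⟨ +-cong (u-comm n 1≤n s) (rest≈ s) ⟩
      commTermT (σ n a) (σ n b) (σ n c′) (σ n d) s + sumT (map commTermTS ts) s ∎
    where open SetoidReasoning

  σ-InComm𝔉 : ∀ {n} → 1 ≤ n → ∀ z → InComm𝔉 z → InCommTS n (σ n z)
  σ-InComm𝔉 {n} 1≤n z (qs , qs-comm , z≈) =
    InCommTS-resp (σ-resp-≈F n z (concat (map termOf qs)) z≈) (σ-concat-commTerms 1≤n qs qs-comm)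

  lift-commTerms : ∀ {n} (ts : List (TS n × TS n × TS n × TS n)) →
                   Σ (List (𝔉 × 𝔉 × 𝔉 × 𝔉 × 𝔉)) λ ps →
                     All IsCommTerm ps × σ n (concat (map termOf ps)) ≈T sumT (map commTermTS ts)
  lift-commTerms []                         = [] , [] , λ _ → ≈-refl
  lift-commTerms {n} ((A , B , C , D) ∷ ts) with ps , ps-comm , rest≈ ← lift-commTerms ts =
    (a , b , c′ , d , u) ∷ ps , (λ k _ → σ-commF k a b c′ d) ∷ ps-comm , λ s → begin
      σ n (u +F concat (map termOf ps)) s
        ≈⟨ σ-+F n u _ s ⟩
      σ n u s + σ n (concat (map termOf ps)) s
        ≈⟨ +-cong (σ-commF n a b c′ d s) (rest≈ s) ⟩
      commTermT (σ n a) (σ n b) (σ n c′) (σ n d) s + sumT (map commTermTS ts) s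
        ≈⟨ +-congʳ (commTermT-cong (lifted A) (lifted B) (lifted C) (lifted D) s) ⟩
      commTermTS (A , B , C , D) s + sumT (map commTermTS ts) s
        ∎
    where
    open SetoidReasoning
    lift : TS n → 𝔉
    lift Y = proj₁ (σ-surjective n Y)
    lifted : ∀ Y → σ n (lift Y) ≈T tensor Y
    lifted Y = proj₂ (σ-surjective n Y)
    a b c′ d u : 𝔉
    a = lift A
    b = lift B
    c′ = lift C
    d = lift D
    u = commF a b c′ d

  σ-InComm𝔉-onto : ∀ {n t} → InCommTS n t → Σ 𝔉 λ z → InComm𝔉 z × σ n z ≈T t
  σ-InComm𝔉-onto (ts , t≈) with ps , ps-comm , σ≈ ← lift-commTerms ts =
    concat (map termOf ps) , (ps , ps-comm , λ _ → ≈-refl) , λ s → ≈-trans (σ≈ s) (≈-sym (t≈ s))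

  In𝔉^+[𝔉,𝔉] : ℕ → 𝔉 → Set (c ⊔ ℓ)
  In𝔉^+[𝔉,𝔉] n x = Σ 𝔉 λ y → Σ 𝔉 λ z → In𝔉^ n y × InComm𝔉 z × (x ≈F (y +F z))

  kernel⊆𝔉^+[𝔉,𝔉] : ∀ {n} x → InCommTS n (σ n x) → In𝔉^+[𝔉,𝔉] n x
  kernel⊆𝔉^+[𝔉,𝔉] {n} x σx∈[TS,TS] = decompose (σ-InComm𝔉-onto σx∈[TS,TS])
    where
    decompose : (Σ 𝔉 λ z → InComm𝔉 z × σ n z ≈T σ n x) → In𝔉^+[𝔉,𝔉] n x
    decompose (z , z∈[𝔉,𝔉] , σz≈σx) =
      x -F z , z , σ≈0⇒In𝔉^ n (x -F z) σ[x-z]≈0 , z∈[𝔉,𝔉] , λ α → ≈-sym (coeff-[x-y]+y x z α)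
      where
      σ[x-z]≈0 : σ n (x -F z) ≈T 0T
      σ[x-z]≈0 s = ≈-trans (σ-subF n x z s) (x≈y⇒x∙y⁻¹≈ε (≈-sym (σz≈σx s)))

  𝔉^+[𝔉,𝔉]⊆kernel : ∀ {n} → 1 ≤ n → ∀ x → In𝔉^+[𝔉,𝔉] n x → InCommTS n (σ n x)
  𝔉^+[𝔉,𝔉]⊆kernel {n} 1≤n x (y , z , y∈𝔉^ , z∈[𝔉,𝔉] , x≈y+z) =
    InCommTS-resp σx≈σz (σ-InComm𝔉 1≤n z z∈[𝔉,𝔉])
    where
    σx≈σz : σ n x ≈T σ n z
    σx≈σz s = begin
      σ n x s            ≈⟨ σ-resp-≈F n x (y +F z) x≈y+z s ⟩
      σ n (y +F z) s     ≈⟨ σ-+F n y z s ⟩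
      σ n y s + σ n z s  ≈⟨ +-congʳ (In𝔉^⇒σ≈0 n y y∈𝔉^ s) ⟩
      0# + σ n z s       ≈⟨ +-identityˡ _ ⟩
      σ n z s            ∎
      where open SetoidReasoning

mainTheorem4 : ∀ {c ℓ : Level} (K : CommutativeRing c ℓ) (m n : ℕ) → 1 ≤ n →
    let open Setup K m in
    -- surjectivity of 𝔉^ab → TS^n(F)^ab
    ((y : TS n) → Σ 𝔉 λ x → InCommTS n (σ n x ⊖ tensor y))
    ×
    -- kernel = image of 𝔉^n in 𝔉^ab
    ((x : 𝔉) → InCommTS n (σ n x) ⇔
       Σ 𝔉 λ y → Σ 𝔉 λ z → In𝔉^ n y × InComm𝔉 z × (x ≈F (y +F z)))
mainTheorem4 K m n 1≤n = surjective , λ x → mk⇔ (kernel⊆𝔉^+[𝔉,𝔉] x) (𝔉^+[𝔉,𝔉]⊆kernel 1≤n x)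
  where
  open Setup K m
  open Presentation K m
  open import Algebra.Properties.Ring (CommutativeRing.ring K) using (x≈y⇒x∙y⁻¹≈ε)

  surjective : (y : TS n) → Σ 𝔉 λ x → InCommTS n (σ n x ⊖ tensor y)
  surjective y = map₂ (λ σx≈y → [] , λ s → x≈y⇒x∙y⁻¹≈ε (σx≈y s)) (σ-surjective n y)
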